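{- Let $\mathbb{T}$ be a (possibly many-sorted) first-order theory over a signature $\Sigma$, let $x$ be a variable of some sort $A$, and let $\phi(x)$ be a formula with only $x$ free. (1) If $\mathbb{T}$ is a universal Horn theory, $\phi(x)$ is a quantifier-free Horn formula and $\mathbb{T}$ proves the sequent $\top \vdash \exists x.\, \phi(x)$, then there is a closed term $t$ of sort $A$ such that $\mathbb{T}$ proves $\top \vdash \phi(t)$. (2) If $\mathbb{T}$ is a universal coherent theory, $\phi(x)$ is a quantifier-free coherent formula and $\mathbb{T}$ proves $\top \vdash \exists x.\, \phi(x)$, then there is a finite set of closed terms $t_1,\dots,t_n$ of sort $A$ such that $\mathbb{T}$ proves $\top \vdash \phi(t_1)\lor\dots\lor\phi(t_n)$. (3) If $\mathbb{T}$ is a universal geometric theory, $\phi(x)$ is a quantifier-free geometric formula and $\mathbb{T}$ proves $\top \vdash \exists x.\, \phi(x)$, then there is a set of closed terms $\{t_i\}_{i\in I}$ of sort $A$ such that $\mathbb{T}$ proves $\top \vdash \bigvee_{i\in I}\phi(t_i)$.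
   Context: Theories are presented in the Gentzen-style sequent calculus of geometric logic and its fragments: an axiom is a sequent $\phi \vdash_{\vec{x}} \psi$ meaning "for all $\vec x$, if $\phi$ then $\psi$", and provability is in the corresponding deductive system (regular logic, with $\land,=,\exists$, in case (1); coherent logic, additionally with finite $\lor$, in case (2); geometric logic, additionally with infinitary $\bigvee$, in case (3)). A quantifier-free Horn formula is built from atomic formulae (instances of relation symbols applied to terms, equalities $s=t$ of terms) and $\top$ using finite $\land$; a quantifier-free coherent formula additionally allows finite disjunctions (including $\bot$); a quantifier-free geometric formula additionally allows arbitrary set-indexed disjunctions. A theory is universal Horn (resp. universal coherent, universal geometric) if every axiom $\phi\vdash_{\vec x}\psi$ has $\phi,\psi$ quantifier-free Horn (resp. coherent, geometric) formulae. A closed term is a term with no free variables; $\phi(t)$ denotes substitution of $t$ for $x$. -}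

module Defs where

-- Syntax and Gentzen-style sequent calculus of (fragments of) geometric
-- logic, following Johnstone, Sketches of an Elephant, D1.1-D1.3.
-- Variables are de Bruijn indices into a typed context (a list of sorts).

open import Level using (Lift; lift)
open import Data.Empty using (⊥)
open import Data.Nat using (ℕ)
open import Data.Fin using (Fin)
open import Data.List using (List; []; _∷_)

record Signature : Set₁ where
  field
    Sort : Set
    Fun  : List Sort → Sort → Set
    Rel  : List Sort → Set

-- Fragments: regular (no disjunction), coherent (finite disjunctions,
-- indexed by Fin n, n = 0 giving ⊥), geometric (arbitrary set-indexed
-- disjunctions).

data Frag : Set where
  regular coherent geometric : Frag

Ix : Frag → Set₁
Ix regular   = Lift _ ⊥
Ix coherent  = Lift _ ℕ
Ix geometric = Set

El : (k : Frag) → Ix k → Set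
El regular   (lift ())
El coherent  (lift n) = Fin n
El geometric I        = I

module Syntax (Sg : Signature) where
  open Signature Sg

  Ctx : Set
  Ctx = List Sort

  data Var : Ctx → Sort → Set where
    vz : ∀ {Γ A} → Var (A ∷ Γ) A
    vs : ∀ {Γ A B} → Var Γ A → Var (B ∷ Γ) A

  mutual
    data Term (Γ : Ctx) : Sort → Set where
      var : ∀ {A} → Var Γ A → Term Γ A
      app : ∀ {As B} → Fun As B → Terms Γ As → Term Γ B

    data Terms (Γ : Ctx) : List Sort → Set where
      []  : Terms Γ []
      _∷_ : ∀ {A As} → Term Γ A → Terms Γ As → Terms Γ (A ∷ As)

  ClosedTerm : Sort → Set
  ClosedTerm = Term []

  Ren : Ctx → Ctx → Set
  Ren Δ Γ = ∀ {A} → Var Γ A → Var Δ A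

  Sub : Ctx → Ctx → Set
  Sub Δ Γ = ∀ {A} → Var Γ A → Term Δ A

  liftR : ∀ {Δ Γ B} → Ren Δ Γ → Ren (B ∷ Δ) (B ∷ Γ)
  liftR ρ vz     = vz
  liftR ρ (vs v) = vs (ρ v)

  mutual
    renT : ∀ {Δ Γ A} → Ren Δ Γ → Term Γ A → Term Δ A
    renT ρ (var v)    = var (ρ v)
    renT ρ (app f ts) = app f (renTs ρ ts)

    renTs : ∀ {Δ Γ As} → Ren Δ Γ → Terms Γ As → Terms Δ As
    renTs ρ []       = []
    renTs ρ (t ∷ ts) = renT ρ t ∷ renTs ρ ts

  liftS : ∀ {Δ Γ B} → Sub Δ Γ → Sub (B ∷ Δ) (B ∷ Γ)
  liftS σ vz     = var vz
  liftS σ (vs v) = renT vs (σ v)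

  mutual
    subT : ∀ {Δ Γ A} → Sub Δ Γ → Term Γ A → Term Δ A
    subT σ (var v)    = σ v
    subT σ (app f ts) = app f (subTs σ ts)

    subTs : ∀ {Δ Γ As} → Sub Δ Γ → Terms Γ As → Terms Δ As
    subTs σ []       = []
    subTs σ (t ∷ ts) = subT σ t ∷ subTs σ ts

  data Formula (k : Frag) (Γ : Ctx) : Set₁ where
    ⊤′   : Formula k Γ
    _∧′_ : Formula k Γ → Formula k Γ → Formula k Γ
    _≐_  : ∀ {A} → Term Γ A → Term Γ A → Formula k Γ
    rel  : ∀ {As} → Rel As → Terms Γ As → Formula k Γ
    ⋁    : (i : Ix k) → (El k i → Formula k Γ) → Formula k Γ
    ∃′   : (A : Sort) → Formula k (A ∷ Γ) → Formula k Γ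

  subF : ∀ {k Δ Γ} → Sub Δ Γ → Formula k Γ → Formula k Δ
  subF σ ⊤′         = ⊤′
  subF σ (φ ∧′ ψ)   = subF σ φ ∧′ subF σ ψ
  subF σ (s ≐ t)    = subT σ s ≐ subT σ t
  subF σ (rel R ts) = rel R (subTs σ ts)
  subF σ (⋁ i f)    = ⋁ i (λ j → subF σ (f j))
  subF σ (∃′ A φ)   = ∃′ A (subF (liftS σ) φ)

  wkF : ∀ {k Γ B} → Formula k Γ → Formula k (B ∷ Γ)
  wkF = subF (λ v → var (vs v))

  _⟨_⟩ : ∀ {k A} → Formula k (A ∷ []) → ClosedTerm A → Formula k []
  φ ⟨ t ⟩ = subF σ φ
    where
      σ : Sub [] (_ ∷ [])
      σ vz = t

  data QF {k : Frag} {Γ : Ctx} : Formula k Γ → Set₁ where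
    ⊤-qf   : QF ⊤′
    ∧-qf   : ∀ {φ ψ} → QF φ → QF ψ → QF (φ ∧′ ψ)
    ≐-qf   : ∀ {A} {s t : Term Γ A} → QF (s ≐ t)
    rel-qf : ∀ {As} {R : Rel As} {ts} → QF (rel R ts)
    ⋁-qf   : ∀ {i f} → (∀ j → QF (f j)) → QF (⋁ i f)

  record Theory (k : Frag) : Set₁ where
    field
      Ax   : Set
      ctx  : Ax → Ctx
      pre  : (a : Ax) → Formula k (ctx a)
      post : (a : Ax) → Formula k (ctx a)

  -- universal Horn / coherent / geometric, according to k
  Universal : ∀ {k} → Theory k → Set₁
  Universal T = ∀ a → QF (Theory.pre T a) × QF (Theory.post T a)
    where open import Data.Product using (_×_)

  -- Derivability  T ▹ φ ⊢[ Γ ] ψ  in the deductive system of fragment k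
  -- (Johnstone D1.3.1; the disjunction, distributivity rules are vacuous
  -- for the regular fragment since it has no disjunctions).

  σ₀ : ∀ {Γ A} → Sub (A ∷ A ∷ Γ) (A ∷ Γ)
  σ₀ vz     = var vz
  σ₀ (vs v) = var (vs (vs v))

  σ₁ : ∀ {Γ A} → Sub (A ∷ A ∷ Γ) (A ∷ Γ)
  σ₁ vz     = var (vs vz)
  σ₁ (vs v) = var (vs (vs v))

  data Der {k : Frag} (T : Theory k) :
       (Γ : Ctx) → Formula k Γ → Formula k Γ → Set₁

  syntax Der T Γ φ ψ = T ▹ φ ⊢[ Γ ] ψ

  data Der {k} T where
    axiom : (a : Theory.Ax T) →
            T ▹ Theory.pre T a ⊢[ Theory.ctx T a ] Theory.post T a
    idn   : ∀ {Γ} {φ : Formula k Γ} → T ▹ φ ⊢[ Γ ] φ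
    cut   : ∀ {Γ} {φ ψ χ : Formula k Γ} →
            T ▹ φ ⊢[ Γ ] ψ → T ▹ ψ ⊢[ Γ ] χ → T ▹ φ ⊢[ Γ ] χ
    subst : ∀ {Γ Δ} {φ ψ : Formula k Γ} (σ : Sub Δ Γ) →
            T ▹ φ ⊢[ Γ ] ψ → T ▹ subF σ φ ⊢[ Δ ] subF σ ψ
    eq-refl : ∀ {Γ A} (v : Var Γ A) → T ▹ ⊤′ ⊢[ Γ ] (var v ≐ var v)
    eq-repl : ∀ {Γ A} (φ : Formula k (A ∷ Γ)) →
              T ▹ ((var vz ≐ var (vs vz)) ∧′ subF σ₀ φ)
                ⊢[ A ∷ A ∷ Γ ] subF σ₁ φ
    ⊤-intro : ∀ {Γ} {φ : Formula k Γ} → T ▹ φ ⊢[ Γ ] ⊤′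
    ∧-elimˡ : ∀ {Γ} {φ ψ : Formula k Γ} → T ▹ (φ ∧′ ψ) ⊢[ Γ ] φ
    ∧-elimʳ : ∀ {Γ} {φ ψ : Formula k Γ} → T ▹ (φ ∧′ ψ) ⊢[ Γ ] ψ
    ∧-intro : ∀ {Γ} {φ ψ χ : Formula k Γ} →
              T ▹ φ ⊢[ Γ ] ψ → T ▹ φ ⊢[ Γ ] χ → T ▹ φ ⊢[ Γ ] (ψ ∧′ χ)
    -- disjunction rules (⊥ ⊢ φ is the case of an empty index)
    ⋁-intro : ∀ {Γ i} (f : El k i → Formula k Γ) (j : El k i) →
              T ▹ f j ⊢[ Γ ] ⋁ i f
    ⋁-elim  : ∀ {Γ i} {f : El k i → Formula k Γ} {ψ : Formula k Γ} →
              (∀ j → T ▹ f j ⊢[ Γ ] ψ) → T ▹ ⋁ i f ⊢[ Γ ] ψ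
    ∃-elim  : ∀ {Γ A} {φ : Formula k (A ∷ Γ)} {ψ : Formula k Γ} →
              T ▹ φ ⊢[ A ∷ Γ ] wkF ψ → T ▹ ∃′ A φ ⊢[ Γ ] ψ
    ∃-elim⁻ : ∀ {Γ A} {φ : Formula k (A ∷ Γ)} {ψ : Formula k Γ} →
              T ▹ ∃′ A φ ⊢[ Γ ] ψ → T ▹ φ ⊢[ A ∷ Γ ] wkF ψ
    distrib : ∀ {Γ i} {φ : Formula k Γ} {f : El k i → Formula k Γ} →
              T ▹ (φ ∧′ ⋁ i f) ⊢[ Γ ] ⋁ i (λ j → φ ∧′ f j)
    frob    : ∀ {Γ A} {φ : Formula k Γ} {ψ : Formula k (A ∷ Γ)} →
              T ▹ (φ ∧′ ∃′ A ψ) ⊢[ Γ ] ∃′ A (wkF φ ∧′ ψ)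

{-# OPTIONS --safe #-}
module Submission where

-- Forcing over the syntactic site of T: stages are closed formulae θ, a stage
-- is covered by any disjunction it provably implies, and a closed substitution
-- is forced at θ on an atom when θ proves the instance, and on ⋁ or ∃ when on
-- some cover of θ a disjunct, resp. a closed witness, is forced.  Forcing is
-- monotone, local and closed under provable equality, and on quantifier-free
-- formulae it coincides with provability; so when the axioms of T are
-- quantifier-free, every derivation of T is sound for it.  Applied to
-- ⊤ ⊢ ∃x φ, soundness yields a cover of ⊤ at each leaf θ of which θ ⊢ φ(t) for
-- some closed t.  Covers are trivial in regular logic and finite in coherent
-- logic, and gluing the cover proves the disjunction of these φ(t).

open import Defs
open import Level using (lift)
open import Data.Nat using (ℕ)
open import Data.Fin using (Fin; zero)
open import Data.List using (List; []; _∷_; [_]; length; lookup; concat; tabulate)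
open import Data.List.Membership.Propositional using (_∈_)
open import Data.List.Membership.Propositional.Properties using (∈-lookup; ∈-concat⁺)
open import Data.List.Relation.Binary.Subset.Propositional using (_⊆_)
open import Data.List.Relation.Unary.Any using (index)
open import Data.List.Relation.Unary.Any.Properties using (lookup-index; tabulate⁺)
open import Data.Product using (Σ; _×_; _,_; proj₁; proj₂)
open import Data.Unit.Polymorphic using (⊤; tt)
open import Function using (_∘_)
open import Relation.Binary.PropositionalEquality as ≡ using (_≡_; refl; sym; trans; cong; cong₂)

module ExistenceProperty (Sg : Signature) where
  open Signature Sg
  open Syntax Sg

  infixr 9 _∘ₛ_
  _∘ₛ_ : ∀ {Θ Δ Γ} → Sub Θ Δ → Sub Δ Γ → Sub Θ Γ
  (σ ∘ₛ τ) v = subT σ (τ v)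

  infix 4 _≗ₛ_
  _≗ₛ_ : ∀ {Δ Γ} → Sub Δ Γ → Sub Δ Γ → Set
  _≗ₛ_ {Γ = Γ} σ σ′ = ∀ {A} (v : Var Γ A) → σ v ≡ σ′ v

  ≗ₛ-sym : ∀ {Δ Γ} {σ σ′ : Sub Δ Γ} → σ ≗ₛ σ′ → σ′ ≗ₛ σ
  ≗ₛ-sym e v = sym (e v)

  ≗ₛ-trans : ∀ {Δ Γ} {σ σ′ σ″ : Sub Δ Γ} → σ ≗ₛ σ′ → σ′ ≗ₛ σ″ → σ ≗ₛ σ″
  ≗ₛ-trans e e′ v = trans (e v) (e′ v)

  mutual
    subT-cong : ∀ {Δ Γ A} {σ σ′ : Sub Δ Γ} → σ ≗ₛ σ′ → (s : Term Γ A) →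
                subT σ s ≡ subT σ′ s
    subT-cong e (var v)    = e v
    subT-cong e (app f ts) = cong (app f) (subTs-cong e ts)

    subTs-cong : ∀ {Δ Γ As} {σ σ′ : Sub Δ Γ} → σ ≗ₛ σ′ → (ts : Terms Γ As) →
                 subTs σ ts ≡ subTs σ′ ts
    subTs-cong e []       = refl
    subTs-cong e (t ∷ ts) = cong₂ _∷_ (subT-cong e t) (subTs-cong e ts)

  mutual
    subT-∘ₛ : ∀ {Θ Δ Γ A} (σ : Sub Θ Δ) (τ : Sub Δ Γ) (s : Term Γ A) →
              subT σ (subT τ s) ≡ subT (σ ∘ₛ τ) s
    subT-∘ₛ σ τ (var v)    = refl
    subT-∘ₛ σ τ (app f ts) = cong (app f) (subTs-∘ₛ σ τ ts)

    subTs-∘ₛ : ∀ {Θ Δ Γ As} (σ : Sub Θ Δ) (τ : Sub Δ Γ) (ts : Terms Γ As) →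
               subTs σ (subTs τ ts) ≡ subTs (σ ∘ₛ τ) ts
    subTs-∘ₛ σ τ []       = refl
    subTs-∘ₛ σ τ (t ∷ ts) = cong₂ _∷_ (subT-∘ₛ σ τ t) (subTs-∘ₛ σ τ ts)

  mutual
    subT-renT : ∀ {Θ Δ Γ A} (σ : Sub Θ Δ) (ρ : Ren Δ Γ) (s : Term Γ A) →
                subT σ (renT ρ s) ≡ subT (λ v → σ (ρ v)) s
    subT-renT σ ρ (var v)    = refl
    subT-renT σ ρ (app f ts) = cong (app f) (subTs-renTs σ ρ ts)

    subTs-renTs : ∀ {Θ Δ Γ As} (σ : Sub Θ Δ) (ρ : Ren Δ Γ) (ts : Terms Γ As) →
                  subTs σ (renTs ρ ts) ≡ subTs (λ v → σ (ρ v)) ts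
    subTs-renTs σ ρ []       = refl
    subTs-renTs σ ρ (t ∷ ts) = cong₂ _∷_ (subT-renT σ ρ t) (subTs-renTs σ ρ ts)

  mutual
    subT-var : ∀ {Γ A} (s : Term Γ A) → subT var s ≡ s
    subT-var (var v)    = refl
    subT-var (app f ts) = cong (app f) (subTs-var ts)

    subTs-var : ∀ {Γ As} (ts : Terms Γ As) → subTs var ts ≡ ts
    subTs-var []       = refl
    subTs-var (t ∷ ts) = cong₂ _∷_ (subT-var t) (subTs-var ts)

  QF-subF : ∀ {k Δ Γ} {φ : Formula k Γ} (σ : Sub Δ Γ) → QF φ → QF (subF σ φ)
  QF-subF σ ⊤-qf      = ⊤-qf
  QF-subF σ (∧-qf p q) = ∧-qf (QF-subF σ p) (QF-subF σ q)
  QF-subF σ ≐-qf      = ≐-qf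
  QF-subF σ rel-qf    = rel-qf
  QF-subF σ (⋁-qf q)  = ⋁-qf (λ j → QF-subF σ (q j))

  []ₛ : ∀ {Δ} → Sub Δ []
  []ₛ ()

  infixl 5 _,ₛ_
  _,ₛ_ : ∀ {Δ Γ A} → Sub Δ Γ → Term Δ A → Sub Δ (A ∷ Γ)
  (σ ,ₛ t) vz     = t
  (σ ,ₛ t) (vs v) = σ v

  tailₛ : ∀ {Δ Γ A} → Sub Δ (A ∷ Γ) → Sub Δ Γ
  tailₛ σ v = σ (vs v)

  ,ₛ-η : ∀ {Δ Γ A} (σ : Sub Δ (A ∷ Γ)) → σ ≗ₛ (tailₛ σ ,ₛ σ vz)
  ,ₛ-η σ vz     = refl
  ,ₛ-η σ (vs v) = refl

  ,ₛ-cong : ∀ {Δ Γ A} {σ σ′ : Sub Δ Γ} (t : Term Δ A) → σ ≗ₛ σ′ → (σ ,ₛ t) ≗ₛ (σ′ ,ₛ t)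
  ,ₛ-cong t e vz     = refl
  ,ₛ-cong t e (vs v) = e v

  ,ₛ-∘ₛ-liftS : ∀ {Θ Δ Γ A} (σ : Sub Θ Δ) (τ : Sub Δ Γ) (t : Term Θ A) →
                (σ ,ₛ t) ∘ₛ liftS τ ≗ₛ (σ ∘ₛ τ) ,ₛ t
  ,ₛ-∘ₛ-liftS σ τ t vz     = refl
  ,ₛ-∘ₛ-liftS σ τ t (vs v) = subT-renT (σ ,ₛ t) vs (τ v)

  wkClosed : ∀ {Δ A} → ClosedTerm A → Term Δ A
  wkClosed = subT []ₛ

  subT-wkClosed : ∀ {Δ A} (σ : Sub [] Δ) (t : ClosedTerm A) → subT σ (wkClosed t) ≡ t
  subT-wkClosed σ t = trans (subT-∘ₛ σ []ₛ t) (trans (subT-cong (λ ()) t) (subT-var t))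

  instHead : ∀ {Γ A} → ClosedTerm A → Sub Γ (A ∷ Γ)
  instHead t = var ,ₛ wkClosed t

  ∘ₛ-instHead : ∀ {Γ A} (σ : Sub [] Γ) (t : ClosedTerm A) → σ ∘ₛ instHead t ≗ₛ σ ,ₛ t
  ∘ₛ-instHead σ t vz     = subT-wkClosed σ t
  ∘ₛ-instHead σ t (vs v) = refl

  module Forcing {k : Frag} (T : Theory k) where

    infix 4 _⊢_
    _⊢_ : Formula k [] → Formula k [] → Set₁
    θ ⊢ ψ = T ▹ θ ⊢[ [] ] ψ

    ⊢-respʳ-≡ : ∀ {θ ψ ψ′} → ψ ≡ ψ′ → θ ⊢ ψ → θ ⊢ ψ′
    ⊢-respʳ-≡ {θ} = ≡.subst (θ ⊢_)

    ≐-refl : ∀ {θ A} (t : ClosedTerm A) → θ ⊢ (t ≐ t)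
    ≐-refl t = cut ⊤-intro (subst ([]ₛ ,ₛ t) (eq-refl vz))

    infix 4 _⊢_≐ₛ_
    _⊢_≐ₛ_ : ∀ {Γ} → Formula k [] → Sub [] Γ → Sub [] Γ → Set₁
    _⊢_≐ₛ_ {Γ} θ σ σ′ = ∀ {A} (v : Var Γ A) → θ ⊢ (σ v ≐ σ′ v)

    ≐ₛ-restrict : ∀ {Γ θ θ′} {σ σ′ : Sub [] Γ} → θ′ ⊢ θ → θ ⊢ σ ≐ₛ σ′ → θ′ ⊢ σ ≐ₛ σ′
    ≐ₛ-restrict h e v = cut h (e v)

    ≐ₛ-,ₛ : ∀ {Γ A θ} {σ σ′ : Sub [] Γ} (t : ClosedTerm A) → θ ⊢ σ ≐ₛ σ′ → θ ⊢ σ ,ₛ t ≐ₛ σ′ ,ₛ t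
    ≐ₛ-,ₛ t e vz     = ≐-refl t
    ≐ₛ-,ₛ t e (vs v) = e v

    data Cover (P : Formula k [] → Set₁) : Formula k [] → Set₁ where
      leaf : ∀ {θ} → P θ → Cover P θ
      node : ∀ {θ} (i : Ix k) (f : El k i → Formula k []) → θ ⊢ ⋁ i f →
             (∀ j → Cover P (θ ∧′ f j)) → Cover P θ

    Cover-map : ∀ {P Q : Formula k [] → Set₁} {θ} →
                (∀ {θ′} → θ′ ⊢ θ → P θ′ → Q θ′) → Cover P θ → Cover Q θ
    Cover-map g (leaf p)        = leaf (g idn p)
    Cover-map g (node i f h cs) = node i f h (λ j → Cover-map (λ h′ → g (cut h′ ∧-elimˡ)) (cs j))

    Cover-restrict : ∀ {P : Formula k [] → Set₁} {θ θ′} →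
                     (∀ {θ₁ θ₂} → θ₂ ⊢ θ₁ → P θ₁ → P θ₂) → θ′ ⊢ θ → Cover P θ → Cover P θ′
    Cover-restrict P-restrict h (leaf p)         = leaf (P-restrict h p)
    Cover-restrict P-restrict h (node i f hc cs) =
      node i f (cut h hc) (λ j → Cover-restrict P-restrict (∧-intro (cut ∧-elimˡ h) ∧-elimʳ) (cs j))

    Cover-join : ∀ {P : Formula k [] → Set₁} {θ} → Cover (Cover P) θ → Cover P θ
    Cover-join (leaf c)        = c
    Cover-join (node i f h cs) = node i f h (λ j → Cover-join (cs j))

    Cover-⊢ : ∀ {χ θ} → Cover (_⊢ χ) θ → θ ⊢ χ
    Cover-⊢ (leaf d)        = d
    Cover-⊢ (node i f h cs) = cut (∧-intro idn h) (cut distrib (⋁-elim (λ j → Cover-⊢ (cs j))))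

    Forces : ∀ {Γ} → Formula k [] → Formula k Γ → Sub [] Γ → Set₁
    Forces θ ⊤′         σ = ⊤
    Forces θ (φ ∧′ ψ)   σ = Forces θ φ σ × Forces θ ψ σ
    Forces θ (s ≐ t)    σ = θ ⊢ (subT σ s ≐ subT σ t)
    Forces θ (rel R ts) σ = θ ⊢ rel R (subTs σ ts)
    Forces θ (⋁ i f)    σ = Cover (λ θ′ → Σ (El k i) (λ j → Forces θ′ (f j) σ)) θ
    Forces θ (∃′ A φ)   σ = Cover (λ θ′ → Σ (ClosedTerm A) (λ t → Forces θ′ φ (σ ,ₛ t))) θ

    forces-restrict : ∀ {Γ θ θ′} (φ : Formula k Γ) {σ : Sub [] Γ} →
                      θ′ ⊢ θ → Forces θ φ σ → Forces θ′ φ σ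
    forces-restrict ⊤′         h x       = x
    forces-restrict (φ ∧′ ψ)   h (x , y) = forces-restrict φ h x , forces-restrict ψ h y
    forces-restrict (s ≐ t)    h x       = cut h x
    forces-restrict (rel R ts) h x       = cut h x
    forces-restrict (⋁ i f)    h c       =
      Cover-restrict (λ h′ (j , x) → j , forces-restrict (f j) h′ x) h c
    forces-restrict (∃′ A φ)   h c       =
      Cover-restrict (λ h′ (t , x) → t , forces-restrict φ h′ x) h c

    forces-local : ∀ {Γ θ} (φ : Formula k Γ) {σ : Sub [] Γ} →
                   Cover (λ θ′ → Forces θ′ φ σ) θ → Forces θ φ σ
    forces-local ⊤′         c = tt
    forces-local (φ ∧′ ψ)   c = forces-local φ (Cover-map (λ _ → proj₁) c) ,
                                forces-local ψ (Cover-map (λ _ → proj₂) c)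
    forces-local (s ≐ t)    c = Cover-⊢ c
    forces-local (rel R ts) c = Cover-⊢ c
    forces-local (⋁ i f)    c = Cover-join c
    forces-local (∃′ A φ)   c = Cover-join c

    forces-resp-≗ : ∀ {Γ θ} (φ : Formula k Γ) {σ σ′ : Sub [] Γ} →
                    σ ≗ₛ σ′ → Forces θ φ σ → Forces θ φ σ′
    forces-resp-≗ ⊤′         e x       = x
    forces-resp-≗ (φ ∧′ ψ)   e (x , y) = forces-resp-≗ φ e x , forces-resp-≗ ψ e y
    forces-resp-≗ (s ≐ t)    e x       =
      ⊢-respʳ-≡ (cong₂ _≐_ (subT-cong e s) (subT-cong e t)) x
    forces-resp-≗ (rel R ts) e x       = ⊢-respʳ-≡ (cong (rel R) (subTs-cong e ts)) x
    forces-resp-≗ (⋁ i f)    e c       =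
      Cover-map (λ _ (j , x) → j , forces-resp-≗ (f j) e x) c
    forces-resp-≗ (∃′ A φ)   e c       =
      Cover-map (λ _ (t , x) → t , forces-resp-≗ φ (,ₛ-cong t e) x) c

    mutual
      forces-subF⁻ : ∀ {Γ Δ θ} (φ : Formula k Γ) (τ : Sub Δ Γ) {σ : Sub [] Δ} →
                     Forces θ (subF τ φ) σ → Forces θ φ (σ ∘ₛ τ)
      forces-subF⁻ ⊤′         τ x       = x
      forces-subF⁻ (φ ∧′ ψ)   τ (x , y) = forces-subF⁻ φ τ x , forces-subF⁻ ψ τ y
      forces-subF⁻ (s ≐ t)    τ {σ} x   =
        ⊢-respʳ-≡ (cong₂ _≐_ (subT-∘ₛ σ τ s) (subT-∘ₛ σ τ t)) x
      forces-subF⁻ (rel R ts) τ {σ} x   = ⊢-respʳ-≡ (cong (rel R) (subTs-∘ₛ σ τ ts)) x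
      forces-subF⁻ (⋁ i f)    τ c       =
        Cover-map (λ _ (j , x) → j , forces-subF⁻ (f j) τ x) c
      forces-subF⁻ (∃′ A φ)   τ {σ} c   =
        Cover-map (λ _ (t , x) →
          t , forces-resp-≗ φ (,ₛ-∘ₛ-liftS σ τ t) (forces-subF⁻ φ (liftS τ) x)) c

      forces-subF⁺ : ∀ {Γ Δ θ} (φ : Formula k Γ) (τ : Sub Δ Γ) {σ : Sub [] Δ} →
                     Forces θ φ (σ ∘ₛ τ) → Forces θ (subF τ φ) σ
      forces-subF⁺ ⊤′         τ x       = x
      forces-subF⁺ (φ ∧′ ψ)   τ (x , y) = forces-subF⁺ φ τ x , forces-subF⁺ ψ τ y
      forces-subF⁺ (s ≐ t)    τ {σ} x   =
        ⊢-respʳ-≡ (sym (cong₂ _≐_ (subT-∘ₛ σ τ s) (subT-∘ₛ σ τ t))) x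
      forces-subF⁺ (rel R ts) τ {σ} x   = ⊢-respʳ-≡ (sym (cong (rel R) (subTs-∘ₛ σ τ ts))) x
      forces-subF⁺ (⋁ i f)    τ c       =
        Cover-map (λ _ (j , x) → j , forces-subF⁺ (f j) τ x) c
      forces-subF⁺ (∃′ A φ)   τ {σ} c   =
        Cover-map (λ _ (t , x) →
          t , forces-subF⁺ φ (liftS τ) (forces-resp-≗ φ (≗ₛ-sym (,ₛ-∘ₛ-liftS σ τ t)) x)) c

    forces-wkF⁻ : ∀ {Γ A θ} (ψ : Formula k Γ) {σ : Sub [] (A ∷ Γ)} →
                  Forces θ (wkF ψ) σ → Forces θ ψ (tailₛ σ)
    forces-wkF⁻ ψ = forces-subF⁻ ψ (λ v → var (vs v))

    forces-wkF⁺ : ∀ {Γ A θ} (ψ : Formula k Γ) {σ : Sub [] (A ∷ Γ)} →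
                  Forces θ ψ (tailₛ σ) → Forces θ (wkF ψ) σ
    forces-wkF⁺ ψ = forces-subF⁺ ψ (λ v → var (vs v))

    forces⇒⊢ : ∀ {Γ θ} {φ : Formula k Γ} {σ : Sub [] Γ} → QF φ → Forces θ φ σ → θ ⊢ subF σ φ
    forces⇒⊢ ⊤-qf       x       = ⊤-intro
    forces⇒⊢ (∧-qf p q) (x , y) = ∧-intro (forces⇒⊢ p x) (forces⇒⊢ q y)
    forces⇒⊢ ≐-qf       x       = x
    forces⇒⊢ rel-qf     x       = x
    forces⇒⊢ {σ = σ} (⋁-qf {f = f} q) c =
      Cover-⊢ (Cover-map (λ _ (j , x) →
        cut (forces⇒⊢ (q j) x) (⋁-intro (λ j → subF σ (f j)) j)) c)

    ⊢⇒forces : ∀ {Γ θ} {φ : Formula k Γ} {σ : Sub [] Γ} → QF φ → θ ⊢ subF σ φ → Forces θ φ σ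
    ⊢⇒forces ⊤-qf       d = tt
    ⊢⇒forces (∧-qf p q) d = ⊢⇒forces p (cut d ∧-elimˡ) , ⊢⇒forces q (cut d ∧-elimʳ)
    ⊢⇒forces ≐-qf       d = d
    ⊢⇒forces rel-qf     d = d
    ⊢⇒forces {σ = σ} (⋁-qf {i = i} {f = f} q) d =
      node i (λ j → subF σ (f j)) d (λ j → leaf (j , ⊢⇒forces (q j) ∧-elimʳ))

    forces-qf-replace-head : ∀ {Γ A θ} {χ : Formula k (A ∷ Γ)} → QF χ →
                             ∀ {ρ : Sub [] Γ} {a b} → θ ⊢ (a ≐ b) →
                             Forces θ χ (ρ ,ₛ a) → Forces θ χ (ρ ,ₛ b)
    forces-qf-replace-head {Γ} {A} {θ} {χ} q {ρ} {a} {b} a≐b x =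
      forces-resp-≗ χ τσ₁ (forces-subF⁻ χ σ₁ (⊢⇒forces (QF-subF σ₁ q) χ[b]))
      where
        τ : Sub [] (A ∷ A ∷ Γ)
        τ = ρ ,ₛ b ,ₛ a
        τσ₀ : ρ ,ₛ a ≗ₛ τ ∘ₛ σ₀
        τσ₀ vz     = refl
        τσ₀ (vs v) = refl
        τσ₁ : τ ∘ₛ σ₁ ≗ₛ ρ ,ₛ b
        τσ₁ vz     = refl
        τσ₁ (vs v) = refl
        χ[a] : θ ⊢ subF τ (subF σ₀ χ)
        χ[a] = forces⇒⊢ (QF-subF σ₀ q) (forces-subF⁺ χ σ₀ (forces-resp-≗ χ τσ₀ x))
        χ[b] : θ ⊢ subF τ (subF σ₁ χ)
        χ[b] = cut (∧-intro a≐b χ[a]) (subst τ (eq-repl χ))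

    -- The variables are replaced one at a time: the head by the equality rule,
    -- the tail by induction after instantiating the head.
    forces-qf-resp-≐ : ∀ {Γ θ} {χ : Formula k Γ} → QF χ → {σ σ′ : Sub [] Γ} →
                       θ ⊢ σ ≐ₛ σ′ → Forces θ χ σ → Forces θ χ σ′
    forces-qf-resp-≐ {[]}    {χ = χ} q e x = forces-resp-≗ χ (λ ()) x
    forces-qf-resp-≐ {A ∷ Γ} {θ} {χ} q {σ} {σ′} e x =
      forces-resp-≗ χ (≗ₛ-trans (∘ₛ-instHead (tailₛ σ′) b) (≗ₛ-sym (,ₛ-η σ′)))
        (forces-subF⁻ χ (instHead b) χ[b][ρ′])
      where
        b : ClosedTerm A
        b = σ′ vz
        χ[b] : Forces θ χ (tailₛ σ ,ₛ b)
        χ[b] = forces-qf-replace-head q (e vz) (forces-resp-≗ χ (,ₛ-η σ) x)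
        χ[b][ρ′] : Forces θ (subF (instHead b) χ) (tailₛ σ′)
        χ[b][ρ′] = forces-qf-resp-≐ (QF-subF (instHead b) q) (λ v → e (vs v))
          (forces-subF⁺ χ (instHead b)
            (forces-resp-≗ χ (≗ₛ-sym (∘ₛ-instHead (tailₛ σ) b)) χ[b]))

    forces-resp-≐ : ∀ {Γ θ} (φ : Formula k Γ) {σ σ′ : Sub [] Γ} →
                    θ ⊢ σ ≐ₛ σ′ → Forces θ φ σ → Forces θ φ σ′
    forces-resp-≐ ⊤′         e x       = x
    forces-resp-≐ (φ ∧′ ψ)   e (x , y) = forces-resp-≐ φ e x , forces-resp-≐ ψ e y
    forces-resp-≐ (s ≐ t)    e x       = forces-qf-resp-≐ (≐-qf {s = s} {t}) e x
    forces-resp-≐ (rel R ts) e x       = forces-qf-resp-≐ rel-qf e x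
    forces-resp-≐ (⋁ i f)    e c       =
      Cover-map (λ h (j , x) → j , forces-resp-≐ (f j) (≐ₛ-restrict h e) x) c
    forces-resp-≐ (∃′ A φ)   e c       =
      Cover-map (λ h (t , x) → t , forces-resp-≐ φ (≐ₛ-,ₛ t (≐ₛ-restrict h e)) x) c

    soundness : Universal T → ∀ {Γ} {φ ψ : Formula k Γ} → T ▹ φ ⊢[ Γ ] ψ →
                ∀ {θ} (σ : Sub [] Γ) → Forces θ φ σ → Forces θ ψ σ
    soundness U (axiom a) σ x =
      ⊢⇒forces (proj₂ (U a)) (cut (forces⇒⊢ (proj₁ (U a)) x) (subst σ (axiom a)))
    soundness U idn σ x = x
    soundness U (cut d e) σ x = soundness U e σ (soundness U d σ x)
    soundness U (subst {φ = φ} {ψ = ψ} τ d) σ x =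
      forces-subF⁺ ψ τ (soundness U d (σ ∘ₛ τ) (forces-subF⁻ φ τ x))
    soundness U (eq-refl v) σ x = ≐-refl (σ v)
    soundness U (eq-repl φ) {θ} σ (a≐b , x) =
      forces-subF⁺ φ σ₁ (forces-resp-≐ φ σσ₀≐σσ₁ (forces-subF⁻ φ σ₀ x))
      where
        σσ₀≐σσ₁ : θ ⊢ σ ∘ₛ σ₀ ≐ₛ σ ∘ₛ σ₁
        σσ₀≐σσ₁ vz     = a≐b
        σσ₀≐σσ₁ (vs v) = ≐-refl _
    soundness U ⊤-intro σ x = tt
    soundness U ∧-elimˡ σ (x , y) = x
    soundness U ∧-elimʳ σ (x , y) = y
    soundness U (∧-intro d e) σ x = soundness U d σ x , soundness U e σ x
    soundness U (⋁-intro f j) σ x = leaf (j , x)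
    soundness U (⋁-elim {ψ = ψ} ds) σ c =
      forces-local ψ (Cover-map (λ _ (j , x) → soundness U (ds j) σ x) c)
    soundness U (∃-elim {ψ = ψ} d) σ c =
      forces-local ψ (Cover-map (λ _ (t , x) → forces-wkF⁻ ψ (soundness U d (σ ,ₛ t) x)) c)
    soundness U (∃-elim⁻ {φ = φ} {ψ = ψ} d) σ x =
      forces-wkF⁺ ψ (soundness U d (tailₛ σ) (leaf (σ vz , forces-resp-≗ φ (,ₛ-η σ) x)))
    soundness U (distrib {φ = φ}) σ (x , c) =
      Cover-map (λ h (j , y) → j , (forces-restrict φ h x , y)) c
    soundness U (frob {φ = φ}) σ (x , c) =
      Cover-map (λ h (t , y) → t , (forces-wkF⁺ φ (forces-restrict φ h x) , y)) c

    Witness : ∀ {A} → Formula k (A ∷ []) → Formula k [] → Set₁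
    Witness {A} φ θ = Σ (ClosedTerm A) (λ t → θ ⊢ φ ⟨ t ⟩)

    forces⇒⊢-⟨⟩ : ∀ {A θ} {φ : Formula k (A ∷ [])} → QF φ → (t : ClosedTerm A) →
                  Forces θ φ ([]ₛ ,ₛ t) → θ ⊢ φ ⟨ t ⟩
    forces⇒⊢-⟨⟩ {φ = φ} q t x = forces⇒⊢ q (forces-resp-≗ φ (λ { vz → refl }) x)

    witness-cover : ∀ {A} {φ : Formula k (A ∷ [])} → Universal T → QF φ →
                    ⊤′ ⊢ ∃′ A φ → Cover (Witness φ) ⊤′
    witness-cover U q d =
      Cover-map (λ _ (t , x) → t , forces⇒⊢-⟨⟩ q t x) (soundness U d []ₛ tt)

  Cover-regular : ∀ {T : Theory regular} {P θ} → Forcing.Cover T P θ → P θ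
  Cover-regular (Forcing.leaf p)                   = p
  Cover-regular (Forcing.node (lift ()) _ _ _)

  module FiniteWitnesses (T : Theory coherent) {A : Sort} (φ : Formula coherent (A ∷ [])) where
    open Forcing T

    ⋁-instances : List (ClosedTerm A) → Formula coherent []
    ⋁-instances ts = ⋁ (lift (length ts)) (λ i → φ ⟨ lookup ts i ⟩)

    instance-⊢-⋁ : ∀ {t ts} → t ∈ ts → φ ⟨ t ⟩ ⊢ ⋁-instances ts
    instance-⊢-⋁ {ts = ts} t∈ts =
      ≡.subst (λ s → φ ⟨ s ⟩ ⊢ ⋁-instances ts) (sym (lookup-index t∈ts))
        (⋁-intro (λ i → φ ⟨ lookup ts i ⟩) (index t∈ts))

    ⋁-instances-⊆ : ∀ {ts us} → ts ⊆ us → ⋁-instances ts ⊢ ⋁-instances us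
    ⋁-instances-⊆ ts⊆us = ⋁-elim (λ i → instance-⊢-⋁ (ts⊆us (∈-lookup i)))

    finite-witnesses : ∀ {θ} → Cover (Witness φ) θ →
                       Σ (List (ClosedTerm A)) (λ ts → θ ⊢ ⋁-instances ts)
    finite-witnesses (leaf (t , d)) = [ t ] , cut d (⋁-intro _ zero)
    finite-witnesses (node (lift n) f h cs) =
      concat (tabulate witnesses) ,
      cut (cut (∧-intro idn h) distrib)
          (⋁-elim (λ j → cut (proj₂ (finite-witnesses (cs j)))
                              (⋁-instances-⊆ (∈-concat⁺ ∘ tabulate⁺ j))))
      where
        witnesses : Fin n → List (ClosedTerm A)
        witnesses j = proj₁ (finite-witnesses (cs j))

  existence-regular : (T : Theory regular) (A : Sort) (φ : Formula regular (A ∷ [])) →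
                      Universal T → QF φ → T ▹ ⊤′ ⊢[ [] ] ∃′ A φ →
                      Σ (ClosedTerm A) (λ t → T ▹ ⊤′ ⊢[ [] ] (φ ⟨ t ⟩))
  existence-regular T A φ U q d = Cover-regular (Forcing.witness-cover T U q d)

  existence-coherent : (T : Theory coherent) (A : Sort) (φ : Formula coherent (A ∷ [])) →
                       Universal T → QF φ → T ▹ ⊤′ ⊢[ [] ] ∃′ A φ →
                       Σ ℕ (λ n → Σ (Fin n → ClosedTerm A) (λ t →
                         T ▹ ⊤′ ⊢[ [] ] ⋁ (lift n) (λ i → φ ⟨ t i ⟩)))
  existence-coherent T A φ U q d
    with FiniteWitnesses.finite-witnesses T φ (Forcing.witness-cover T U q d)
  ... | ts , ⊤⊢⋁ = length ts , lookup ts , ⊤⊢⋁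

  existence-geometric : (T : Theory geometric) (A : Sort) (φ : Formula geometric (A ∷ [])) →
                        Universal T → QF φ → T ▹ ⊤′ ⊢[ [] ] ∃′ A φ →
                        Σ Set (λ I → Σ (I → ClosedTerm A) (λ t →
                          T ▹ ⊤′ ⊢[ [] ] ⋁ I (λ i → φ ⟨ t i ⟩)))
  existence-geometric T A φ U q d =
    ClosedTerm A , (λ t → t) ,
    Cover-⊢ (Cover-map (λ _ (t , ⊢φt) → cut ⊢φt (⋁-intro (λ t → φ ⟨ t ⟩) t))
                       (witness-cover U q d))
    where open Forcing T

corollary3p2 : (Sg : Signature) →
    let open Signature Sg
        open Syntax Sg
    in
    -- (1) universal Horn theories
    ((T : Theory regular) (A : Sort) (φ : Formula regular (A ∷ [])) →
       Universal T → QF φ → T ▹ ⊤′ ⊢[ [] ] ∃′ A φ →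
       Σ (ClosedTerm A) (λ t → T ▹ ⊤′ ⊢[ [] ] (φ ⟨ t ⟩)))
    ×
    -- (2) universal coherent theories
    ((T : Theory coherent) (A : Sort) (φ : Formula coherent (A ∷ [])) →
       Universal T → QF φ → T ▹ ⊤′ ⊢[ [] ] ∃′ A φ →
       Σ ℕ (λ n → Σ (Fin n → ClosedTerm A) (λ t →
         T ▹ ⊤′ ⊢[ [] ] ⋁ (lift n) (λ i → φ ⟨ t i ⟩))))
    ×
    -- (3) universal geometric theories
    ((T : Theory geometric) (A : Sort) (φ : Formula geometric (A ∷ [])) →
       Universal T → QF φ → T ▹ ⊤′ ⊢[ [] ] ∃′ A φ →
       Σ Set (λ I → Σ (I → ClosedTerm A) (λ t →
         T ▹ ⊤′ ⊢[ [] ] ⋁ I (λ i → φ ⟨ t i ⟩))))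
corollary3p2 Sg = existence-regular , existence-coherent , existence-geometric
  where open ExistenceProperty Sg
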